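{- Let $A:\mathcal{U}$, $B:A\to\mathcal{U}$, and let $W_{AB}$, $\mathsf{sup}$, $\mathsf{rec}_W$ be as in the context. Then $\mathsf{rec}_W\ W_{AB}\ \mathsf{sup} = \mathrm{id}_{W_{AB}}$.
   Context: Type theory: intensional Martin-Löf type theory with universes $\mathcal{U}:\mathcal{U}_0:\cdots$, bottom universe $\mathcal{U}$ impredicative (if $A$ is a type in any universe and $a:A\vdash B:\mathcal{U}$ then $\prod_{a:A}B:\mathcal{U}$), universes closed under $\Sigma$ and identity types; $\pi_1,\pi_2$ projections, $f\circ g := \lambda x.f(g\,x)$. Axioms: function extensionality and UIP. Fix $A:\mathcal{U}$, $B:A\to\mathcal{U}$. Impredicative W-type: $W^*_{AB} := \prod_{X:\mathcal{U}}\big(\prod_{a:A}(B(a)\to X)\to X\big)\to X$; for $a:A$, $r:B(a)\to W^*_{AB}$: $\mathsf{sup}^*\,a\,r := \lambda X\,g.\ g\,a\,(\lambda b.\ r\,b\,X\,g)$; $\mathsf{rec}^*_W\,X\,g\,w := w\,X\,g$. For $g:\prod_{a:A}(B(a)\to X)\to X$, $g':\prod_{a:A}(B(a)\to Y)\to Y$, $f:X\to Y$: $\mathsf{MorphW}\,X\,g\ Y\,g'\ f := \prod_{a:A}\prod_{t:B(a)\to X} f(g\,a\,t) = g'\,a\,(f\circ t)$. $\mathsf{LimW}\,w := \prod_{X,Y:\mathcal{U}}\prod_{g,g'}\prod_{f:X\to Y}\mathsf{MorphW}\,X\,g\ Y\,g'\ f\to f(\mathsf{rec}^*_W\,X\,g\,w)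 = \mathsf{rec}^*_W\,Y\,g'\,w$ ($g,g'$ of the types just given). $W_{AB} := \sum_{w:W^*_{AB}}\mathsf{LimW}\,w$. There is a proof $p:\prod_{a:A}\prod_{r:B(a)\to W_{AB}}\mathsf{LimW}(\mathsf{sup}^*\,a\,(\pi_1\circ r))$; set $\mathsf{sup}\,a\,r := \langle\mathsf{sup}^*\,a\,(\pi_1\circ r), p\,a\,r\rangle$ and $\mathsf{rec}_W\,X\,g\,w := \mathsf{rec}^*_W\,X\,g\,(\pi_1 w)$. -}

module Defs where

open import Level using (Level; Setω)
open import Data.Product using (Σ; proj₁; proj₂; _,_)
open import Relation.Binary.PropositionalEquality using (_≡_)
open import Function using (_∘_)

-- The bottom universe 𝒰 is rendered as Agda's Set.  Agda's Set is
-- predicative, so impredicativity of 𝒰 is supplied as a structure: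
-- for every type A in any universe and family B : A → Set, a small
-- type Π* A B in Set together with an isomorphism (β and η laws,
-- up to propositional equality) with the dependent function type.
record Impredicative : Setω where
  field
    Π*  : ∀ {ℓ} (A : Set ℓ) (B : A → Set) → Set
    lam : ∀ {ℓ} {A : Set ℓ} {B : A → Set} → ((a : A) → B a) → Π* A B
    app : ∀ {ℓ} {A : Set ℓ} {B : A → Set} → Π* A B → (a : A) → B a
    β   : ∀ {ℓ} {A : Set ℓ} {B : A → Set} (f : (a : A) → B a) → app (lam f) ≡ f
    η   : ∀ {ℓ} {A : Set ℓ} {B : A → Set} (h : Π* A B) → lam (app h) ≡ h

FunExt : Setω
FunExt = ∀ {a b : Level} {X : Set a} {Y : X → Set b} {f g : (x : X) → Y x} →
         ((x : X) → f x ≡ g x) → f ≡ g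

UIP : Setω
UIP = ∀ {a : Level} {X : Set a} {x y : X} (p q : x ≡ y) → p ≡ q

module WTypes (I : Impredicative) (A : Set) (B : A → Set) where
  open Impredicative I

  Alg : Set → Set
  Alg X = (a : A) → (B a → X) → X

  W* : Set
  W* = Π* Set (λ X → Alg X → X)

  sup* : (a : A) → (B a → W*) → W*
  sup* a r = lam (λ X g → g a (λ b → app (r b) X g))

  rec*W : (X : Set) → Alg X → W* → X
  rec*W X g w = app w X g

  MorphW : (X : Set) → Alg X → (Y : Set) → Alg Y → (X → Y) → Set
  MorphW X g Y g' f = (a : A) (t : B a → X) → f (g a t) ≡ g' a (f ∘ t)

  LimW : W* → Set
  LimW w = Π* Set (λ X → Π* Set (λ Y → (g : Alg X) (g' : Alg Y) (f : X → Y) →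
             MorphW X g Y g' f → f (rec*W X g w) ≡ rec*W Y g' w))

  W : Set
  W = Σ W* LimW

  -- sup is parametrised by the proof p of the context
  SupProof : Set
  SupProof = (a : A) (r : B a → W) → LimW (sup* a (proj₁ ∘ r))

  sup : SupProof → (a : A) → (B a → W) → W
  sup p a r = sup* a (proj₁ ∘ r) , p a r

  recW : (X : Set) → Alg X → W → X
  recW X g w = rec*W X g (proj₁ w)

{-# OPTIONS --safe #-}
-- For each algebra (X, g) the map rec*W X g is an algebra morphism
-- from (W*, sup*) to (X, g), so the naturality condition LimW w applied to it
-- gives rec*W X g (rec*W W* sup* w) ≡ rec*W X g w for all X and g, that is,
-- rec*W W* sup* w ≡ w.  The projection W → W* is a morphism from (W, sup) to
-- (W*, sup*), so naturality also moves recW W sup to rec*W W* sup* on first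
-- components; the second components agree since LimW w is a proposition
-- under function extensionality and UIP.
module Submission where

open import Defs
open import Function using (id)
open import Data.Product using (proj₁; _,_)
open import Relation.Binary.PropositionalEquality

module _ (I : Impredicative) where
  open Impredicative I

  app-injective : ∀ {ℓ} {X : Set ℓ} {Y : X → Set} {h h' : Π* X Y} →
                  app h ≡ app h' → h ≡ h'
  app-injective {h = h} {h'} e = begin
    h             ≡⟨ η h ⟨
    lam (app h)   ≡⟨ cong lam e ⟩
    lam (app h')  ≡⟨ η h' ⟩
    h'            ∎
    where open ≡-Reasoning

module WProperties (I : Impredicative) (fe : FunExt) (uip : UIP) (A : Set) (B : A → Set) where
  open Impredicative I
  open WTypes I A B

  LimW-irrelevant : (w : W*) (l l' : LimW w) → l ≡ l'
  LimW-irrelevant w l l' = app-injective I (fe λ X → app-injective I (fe λ Y →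
    fe λ g → fe λ g' → fe λ f → fe λ m → uip _ _))

  W-≡ : {w w' : W} → proj₁ w ≡ proj₁ w' → w ≡ w'
  W-≡ {w , l} {.w , l'} refl = cong (w ,_) (LimW-irrelevant w l l')

  LimW-natural : {w : W*} → LimW w → (X Y : Set) (g : Alg X) (g' : Alg Y) (f : X → Y) →
                 MorphW X g Y g' f → f (rec*W X g w) ≡ rec*W Y g' w
  LimW-natural l X Y = app (app l X) Y

  rec*W-isMorphism : (X : Set) (g : Alg X) → MorphW W* sup* X g (rec*W X g)
  rec*W-isMorphism X g a t =
    cong (λ k → k X g) (β {B = λ Z → Alg Z → Z} (λ Z h → h a (λ b → app (t b) Z h)))

  proj₁-isMorphism : (p : SupProof) → MorphW W (sup p) W* sup* proj₁
  proj₁-isMorphism p a t = refl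

  rec*W-sup*-fixes-LimW : {w : W*} → LimW w → rec*W W* sup* w ≡ w
  rec*W-sup*-fixes-LimW {w} l = app-injective I (fe λ X → fe λ g →
    LimW-natural l W* X sup* g (rec*W X g) (rec*W-isMorphism X g))

lemma8p4p7 : (I : Impredicative) → FunExt → UIP →
    (A : Set) (B : A → Set) (p : WTypes.SupProof I A B) →
    WTypes.recW I A B (WTypes.W I A B) (WTypes.sup I A B p) ≡ id
lemma8p4p7 I fe uip A B p = fe λ { (w , l) → W-≡ (begin
  proj₁ (rec*W W (sup p) w)  ≡⟨ LimW-natural l W W* (sup p) sup* proj₁
                                   (proj₁-isMorphism p) ⟩
  rec*W W* sup* w            ≡⟨ rec*W-sup*-fixes-LimW l ⟩
  w                          ∎) }
  where
  open WTypes I A B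
  open WProperties I fe uip A B
  open ≡-Reasoning
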